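{- Let $n\ge1$ and $a\ge 3$ be integers with $2a-2<n$, and let $\sigma$ be a uniformly random permutation of $\{1,\ldots,n\}$. Then for every integer $t$, $\Pr[D_{a,a-2}(\sigma)\equiv t\pmod n]\le\frac1{n-1}$.
   Context: For positive integers $a,b$ with $a+b<n$ and a permutation $\sigma$ of $\{1,\ldots,n\}$, define $D_{a,b}(\sigma)=\sum_{i=1}^{a}\sigma(i)-\sum_{i=a+1}^{a+b}\sigma(i)$. -}

module Defs where

open import Data.Nat using (ℕ; suc; _<_; _<ᵇ_; _≤ᵇ_)
open import Data.Nat.Properties using ()
open import Data.Bool using (Bool; _∧_; if_then_else_)
open import Data.Fin using (Fin; toℕ)
open import Data.List using (List; allFin; map; filterᵇ)
open import Data.Nat.ListAction using (sum)
open import Data.Integer using (ℤ; +_; _-_)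
open import Data.Fin.Permutation using (Permutation′; _⟨$⟩ʳ_)
open import Data.Product using (∃)
open import Relation.Binary.PropositionalEquality using (_≢_)

-- Position i ∈ {1,…,n} corresponds to j : Fin n with toℕ j = i - 1, and the value
-- σ(i) ∈ {1,…,n} is toℕ (σ ⟨$⟩ʳ j) + 1.
val : {n : ℕ} → Permutation′ n → Fin n → ℕ
val σ j = suc (toℕ (σ ⟨$⟩ʳ j))

-- sum of σ(i) over positions i (1-based) with lo < i ≤ hi, i.e. 0-based lo ≤ toℕ j < hi
sumPos : {n : ℕ} → Permutation′ n → ℕ → ℕ → ℕ
sumPos {n} σ lo hi =
  sum (map (val σ) (filterᵇ (λ j → (lo ≤ᵇ toℕ j) ∧ (toℕ j <ᵇ hi)) (allFin n)))

-- D_{a,b}(σ) = Σ_{i=1}^{a} σ(i) − Σ_{i=a+1}^{a+b} σ(i)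
D : {n : ℕ} → ℕ → ℕ → Permutation′ n → ℤ
D a b σ = (+ sumPos σ 0 a) - (+ sumPos σ a (a Data.Nat.+ b))

Distinct : {n : ℕ} → Permutation′ n → Permutation′ n → Set
Distinct σ τ = ∃ λ j → σ ⟨$⟩ʳ j ≢ τ ⟨$⟩ʳ j

-- Rotating every value by one (v ↦ v + 1 mod n) changes D_{a,a-2} by a − (a − 2) = 2 modulo n, so
-- iterated rotation maps the class {σ : D(σ) ≡ t} injectively into the classes of t + 2, t + 4, … .
-- For odd n these are n distinct residues, so the class has at most n!/n elements. For even n = 2h
-- they are the h residues of one parity, and it suffices to bound a parity class B by n!·n/(2(n − 1)).
-- Pair the values as {0,1}, {2,3}, … and cut the positions after k = 2a − 2. Exchanging the two
-- values of the first pair split by the cut is an injection that changes D by ±1, so it maps the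
-- permutations of B with a split pair injectively outside B: |B| + |B with a split pair| ≤ n!.
-- A permutation with no split pair ("closed") has n − 2 non-closed neighbours, obtained by swapping
-- position 0 with a position ≥ k or position k with a position in (0, k), and distinct closed
-- permutations have disjoint neighbourhoods, so at most n!/(n − 1) permutations are closed.
-- Adding the two estimates gives 2|B| ≤ n! + n!/(n − 1).
module Submission where

open import Defs
open import Data.Nat using (ℕ; _≤_; _<_; _*_; _∸_; _+_)
open import Data.Nat using (_!)
open import Data.Integer using (ℤ; +_; _-_)
open import Data.Integer.Divisibility using (_∣_)
open import Data.Fin.Permutation using (Permutation′)
open import Data.List using (List; length)
open import Data.List.Relation.Unary.All using (All)
open import Data.List.Relation.Unary.AllPairs using (AllPairs)

open import Data.Bool using (Bool; true; false; if_then_else_; _∧_; _xor_; not; T)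
open import Data.Bool.Properties using (T-≡; ¬-not; xor-comm)
import Data.Bool as Bool
open import Data.Empty using (⊥-elim)
open import Data.Fin using (Fin; zero; suc; toℕ; fromℕ; fromℕ<; inject₁; lower₁; punchIn; punchOut; _≟_)
open import Data.Fin.Properties using (¬∀⟶∃¬; all?; toℕ-injective; toℕ<n; toℕ-fromℕ; toℕ-fromℕ<;
  toℕ-lower₁; toℕ-inject₁-≢; lower₁-inject₁′; inject₁-lower₁; punchOut-injective; punchInᵢ≢i)
open import Data.Fin.Permutation
  using (_⟨$⟩ʳ_; _⟨$⟩ˡ_; _≈_; _∘ₚ_; permutation; transpose; remove; inverseˡ; inverseʳ)
import Data.Fin.Permutation.Components as PC
import Data.Integer as ℤ
import Data.Integer.Properties as ℤₚ
import Data.Integer.Divisibility.Signed as Signed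
open import Data.Integer.Tactic.RingSolver using (solve-∀)
open import Data.List using ([]; _∷_; _++_; map; concat; filter; filterᵇ; tabulate; allFin)
open import Data.List.Properties using (length-map; length-++; map-cong)
import Data.List.Relation.Unary.All as All
open import Data.List.Relation.Unary.All using ([]; _∷_)
import Data.List.Relation.Unary.All.Properties as Allₚ
import Data.List.Relation.Unary.AllPairs as AllPairs
open import Data.List.Relation.Unary.AllPairs using ([]; _∷_)
import Data.List.Relation.Unary.AllPairs.Properties as AllPairsₚ
open import Data.Maybe as Maybe using (Maybe; just; nothing)
open import Data.Nat using (zero; suc; z≤n; s≤s; _<ᵇ_)
import Data.Nat.Properties as ℕₚ
open import Data.Nat.Divisibility as ℕDiv using () renaming (_∣_ to _∣ℕ_; divides to ℕdivides)
open import Data.Nat.ListAction using (sum)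
import Data.Nat.Tactic.RingSolver as ℕSolver
open import Data.Product using (∃; _,_; _×_; proj₂)
open import Data.Sum using (_⊎_; inj₁; inj₂; swap)
open import Data.Vec.Functional using (removeAt)
open import Function using (_∘_)
open import Function.Bundles using (Equivalence)
open import Relation.Binary.PropositionalEquality
open import Relation.Nullary using (¬_; Dec; yes; no; does)
open import Relation.Nullary.Decidable using (dec-true; dec-false; _×-dec_; ¬?; T?)
open import Relation.Unary using (Decidable)

open import Algebra.Properties.CommutativeMonoid.Sum ℕₚ.+-0-commutativeMonoid
  using (sum-syntax; sum-cong-≗; ∑-distrib-+; sum-remove; sum-replicate-zero)
  renaming (sum to ∑)

-- Finite sums and lists
∑-mono-≤ : ∀ {n} {f g : Fin n → ℕ} → (∀ i → f i ≤ g i) → ∑ f ≤ ∑ g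
∑-mono-≤ {zero}  f≤g = z≤n
∑-mono-≤ {suc n} f≤g = ℕₚ.+-mono-≤ (f≤g zero) (∑-mono-≤ (f≤g ∘ suc))

∑-≤-* : ∀ {n B} {f : Fin n → ℕ} → (∀ i → f i ≤ B) → ∑ f ≤ n * B
∑-≤-* {zero}  f≤B = z≤n
∑-≤-* {suc n} f≤B = ℕₚ.+-mono-≤ (f≤B zero) (∑-≤-* (f≤B ∘ suc))

δ : ∀ {n} → Fin n → Fin n → ℕ
δ i j = if does (i ≟ j) then 1 else 0

∑-δ : ∀ {n} (i : Fin n) → ∑ (δ i) ≡ 1
∑-δ {suc n} zero    = cong suc (sum-replicate-zero n)
∑-δ {suc n} (suc i) = ∑-δ i

indicator-∧-not-≤ : ∀ r e {d} → (e ≡ true → d ≡ 1) →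
  (if r then 1 else 0) ≤ (if r ∧ not e then 1 else 0) + d
indicator-∧-not-≤ false e     _   = z≤n
indicator-∧-not-≤ true  false _   = s≤s z≤n
indicator-∧-not-≤ true  true  hit = ℕₚ.≤-reflexive (sym (hit refl))

∑-update : ∀ {n} (f f′ : Fin n → ℕ) (p : Fin n) → (∀ j → j ≢ p → f′ j ≡ f j) →
  ∑ f′ + f p ≡ ∑ f + f′ p
∑-update {suc n} f f′ p agree = begin
  ∑ f′ + f p                          ≡⟨ cong (_+ f p) (sum-remove {i = p} f′) ⟩
  (f′ p + ∑ (removeAt f′ p)) + f p    ≡⟨ cong (λ s → (f′ p + s) + f p) (sum-cong-≗ agree-elsewhere) ⟩
  (f′ p + ∑ (removeAt f p)) + f p     ≡⟨ exchange (f′ p) (∑ (removeAt f p)) (f p) ⟩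
  (f p + ∑ (removeAt f p)) + f′ p     ≡⟨ cong (_+ f′ p) (sum-remove {i = p} f) ⟨
  ∑ f + f′ p                          ∎
  where
  open ≡-Reasoning
  agree-elsewhere : removeAt f′ p ≗ removeAt f p
  agree-elsewhere j = agree (punchIn p j) (punchInᵢ≢i p j)
  exchange : ∀ x y z → (x + y) + z ≡ (z + y) + x
  exchange = ℕSolver.solve-∀

sum-filter : ∀ {N} {P : Fin N → Set} n (g : Fin n → Fin N) (P? : Decidable P) (f : Fin N → ℕ) →
  sum (map f (filter P? (tabulate g))) ≡ ∑[ j < n ] (if does (P? (g j)) then f (g j) else 0)
sum-filter zero    g P? f = refl
sum-filter (suc n) g P? f with does (P? (g zero))
... | true  = cong (λ s → f (g zero) + s) (sum-filter n (g ∘ suc) P? f)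
... | false = sum-filter n (g ∘ suc) P? f

length-filter-allFin : ∀ {n} {P : Fin n → Set} (P? : Decidable P) →
  length (filter P? (allFin n)) ≡ ∑[ j < n ] (if does (P? j) then 1 else 0)
length-filter-allFin {n} P? =
  trans (sym (sum-map-1 (filter P? (allFin n)))) (sum-filter n (λ j → j) P? (λ _ → 1))
  where
  sum-map-1 : ∀ {A : Set} (xs : List A) → sum (map (λ _ → 1) xs) ≡ length xs
  sum-map-1 []       = refl
  sum-map-1 (_ ∷ xs) = cong suc (sum-map-1 xs)

inRange? : ∀ {n} lo hi (j : Fin n) → Dec (lo ≤ toℕ j × toℕ j < hi)
inRange? lo hi j = (lo ℕₚ.≤? toℕ j) ×-dec (toℕ j ℕₚ.<? hi)

∑-inRange : ∀ n lo hi → hi ≤ n → ∑[ j < n ] (if does (inRange? lo hi j) then 1 else 0) ≡ hi ∸ lo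
∑-inRange zero    lo       zero     _         = sym (ℕₚ.0∸n≡0 lo)
∑-inRange (suc n) lo       zero     _         = begin
  ∑[ j < suc n ] (if does (inRange? lo 0 j) then 1 else 0) ≡⟨ sum-cong-≗ {suc n} empty ⟩
  ∑[ j < suc n ] 0                                          ≡⟨ sum-replicate-zero (suc n) ⟩
  0                                                         ≡⟨ ℕₚ.0∸n≡0 lo ⟨
  0 ∸ lo                                                    ∎
  where
  open ≡-Reasoning
  empty : ∀ j → (if does (inRange? lo 0 j) then 1 else 0) ≡ 0
  empty j = cong (λ b → if b then 1 else 0) (dec-false (inRange? lo 0 j) (λ { (_ , ()) }))
∑-inRange (suc n) zero     (suc hi) (s≤s hi≤n) = cong suc (∑-inRange n zero hi hi≤n)
∑-inRange (suc n) (suc lo) (suc hi) (s≤s hi≤n) = trans (sum-cong-≗ {n} (shift lo)) (∑-inRange n lo hi hi≤n)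
  where
  shift : ∀ lo j → (if does (inRange? (suc lo) (suc hi) (suc j)) then 1 else 0) ≡
                   (if does (inRange? lo hi j) then 1 else 0)
  shift zero    j = refl
  shift (suc _) j = refl

module _ {A : Set} {k : ℕ} (h : A → Fin k) where

  fibre : Fin k → List A → List A
  fibre c = filter (λ x → h x ≟ c)

  length≡∑-fibres : ∀ xs → length xs ≡ ∑[ c < k ] length (fibre c xs)
  length≡∑-fibres []       = sym (sum-replicate-zero k)
  length≡∑-fibres (x ∷ xs) = begin
    suc (length xs)                                 ≡⟨ cong₂ _+_ (sym (∑-δ (h x))) (length≡∑-fibres xs) ⟩
    ∑ (δ (h x)) + ∑ (λ c → length (fibre c xs))     ≡⟨ ∑-distrib-+ (δ (h x)) (λ c → length (fibre c xs)) ⟨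
    ∑ (λ c → δ (h x) c + length (fibre c xs))       ≡⟨ sum-cong-≗ fibre-∷ ⟩
    ∑ (λ c → length (fibre c (x ∷ xs)))             ∎
    where
    open ≡-Reasoning
    fibre-∷ : ∀ c → δ (h x) c + length (fibre c xs) ≡ length (fibre c (x ∷ xs))
    fibre-∷ c with h x ≟ c
    ... | yes _ = refl
    ... | no  _ = refl

  length-≤-fibres : ∀ {B} xs → (∀ c → length (fibre c xs) ≤ B) → length xs ≤ k * B
  length-≤-fibres xs bound = ℕₚ.≤-trans (ℕₚ.≤-reflexive (length≡∑-fibres xs)) (∑-≤-* bound)

allPairs-restrict : ∀ {A : Set} {P : A → Set} {R S : A → A → Set} →
  (∀ {x y} → P x → P y → R x y → S x y) → ∀ {xs} → All P xs → AllPairs R xs → AllPairs S xs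
allPairs-restrict f []         []         = []
allPairs-restrict f (px ∷ pxs) (rx ∷ rxs) =
  All.zipWith (λ (py , r) → f px py r) (pxs , rx) ∷ allPairs-restrict f pxs rxs

All-All : ∀ {A : Set} {P Q : A → Set} {R : A → A → Set} → (∀ {x y} → P x → Q y → R x y) →
  ∀ {xs ys} → All P xs → All Q ys → All (λ x → All (R x) ys) xs
All-All r pxs qys = All.map (λ px → All.map (r px) qys) pxs

allFin-distinct : ∀ {n} → AllPairs _≢_ (allFin n)
allFin-distinct = AllPairsₚ.tabulate⁺ (λ i≢j → i≢j)

length-concat-≥ : ∀ {A B : Set} {P : A → Set} (f : A → List B) {c} → (∀ {x} → P x → c ≤ length (f x)) →
  ∀ {xs} → All P xs → length xs * c ≤ length (concat (map f xs))
length-concat-≥ f bound []               = z≤n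
length-concat-≥ f bound {x ∷ xs} (px ∷ pxs) = ℕₚ.≤-trans
  (ℕₚ.+-mono-≤ (bound px) (length-concat-≥ f bound pxs)) (ℕₚ.≤-reflexive (sym (length-++ (f x))))

length-partition : ∀ {A : Set} {P : A → Set} (P? : Decidable P) xs →
  length (filter P? xs) + length (filter (¬? ∘ P?) xs) ≡ length xs
length-partition P? []       = refl
length-partition P? (x ∷ xs) with does (P? x)
... | true  = cong suc (length-partition P? xs)
... | false = trans (ℕₚ.+-suc _ _) (cong suc (length-partition P? xs))

firstWhere : ∀ {n} → (Fin n → Bool) → Maybe (Fin n)
firstWhere {zero}  P = nothing
firstWhere {suc n} P = if P zero then just zero else Maybe.map suc (firstWhere (P ∘ suc))

firstWhere-cong : ∀ {n} {P Q : Fin n → Bool} → P ≗ Q → firstWhere P ≡ firstWhere Q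
firstWhere-cong {zero}          _   = refl
firstWhere-cong {suc n} {P} {Q} P≗Q rewrite P≗Q zero =
  cong (λ r → if Q zero then just zero else Maybe.map suc r) (firstWhere-cong (P≗Q ∘ suc))

firstWhere-just : ∀ {n} {P : Fin n → Bool} {x} → firstWhere P ≡ just x → P x ≡ true
firstWhere-just {suc n} {P} found with P zero in P₀ | firstWhere (P ∘ suc) in rest | found
... | true  | _      | refl = P₀
... | false | just y | refl = firstWhere-just rest

firstWhere-nothing : ∀ {n} {P : Fin n → Bool} → firstWhere P ≡ nothing → ∀ x → P x ≡ false
firstWhere-nothing {suc n} {P} none x with P zero in P₀ | firstWhere (P ∘ suc) in rest | none | x
... | false | nothing | refl | zero  = P₀
... | false | nothing | refl | suc y = firstWhere-nothing rest y

-- Congruences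

-- A record rather than a function into Signed._∣_, so that x and y stay visible to unification
-- (ℤ addition of two literals +_ m and +_ n computes, which would otherwise lose them).
infix 4 _≡_mod_
record _≡_mod_ (x y : ℤ) (n : ℕ) : Set where
  constructor mod-intro
  field divides-difference : + n Signed.∣ (x - y)

open _≡_mod_

module _ {n : ℕ} where

  mod-reflexive : ∀ {x y} → x ≡ y → x ≡ y mod n
  mod-reflexive {x} refl = mod-intro (Signed.divides (+ 0) (ℤₚ.+-inverseʳ x))

  mod-cong : ∀ {x x′ y y′} → x ≡ x′ → y ≡ y′ → x ≡ y mod n → x′ ≡ y′ mod n
  mod-cong refl refl x≡y = x≡y

  mod-trans : ∀ {x y z} → x ≡ y mod n → y ≡ z mod n → x ≡ z mod n
  mod-trans {x} {y} {z} (mod-intro x≡y) (mod-intro y≡z) =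
    mod-intro (subst (+ n Signed.∣_) (telescope x y z) (Signed.∣m∣n⇒∣m+n x≡y y≡z))
    where
    telescope : ∀ x y z → (x - y) ℤ.+ (y - z) ≡ x - z
    telescope = solve-∀

  mod-sym : ∀ {x y} → x ≡ y mod n → y ≡ x mod n
  mod-sym {x} {y} (mod-intro n∣x-y) =
    mod-intro (subst (+ n Signed.∣_) (negate x y) (Signed.∣m⇒∣-m n∣x-y))
    where
    negate : ∀ x y → ℤ.- (x - y) ≡ y - x
    negate = solve-∀

  mod-+ : ∀ {x y u v} → x ≡ y mod n → u ≡ v mod n → x ℤ.+ u ≡ y ℤ.+ v mod n
  mod-+ {x} {y} {u} {v} (mod-intro x≡y) (mod-intro u≡v) =
    mod-intro (subst (+ n Signed.∣_) (regroup x y u v) (Signed.∣m∣n⇒∣m+n x≡y u≡v))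
    where
    regroup : ∀ x y u v → (x - y) ℤ.+ (u - v) ≡ (x ℤ.+ u) - (y ℤ.+ v)
    regroup = solve-∀

  mod-- : ∀ {x y u v} → x ≡ y mod n → u ≡ v mod n → x - u ≡ y - v mod n
  mod-- {x} {y} {u} {v} (mod-intro x≡y) (mod-intro u≡v) =
    mod-intro (subst (+ n Signed.∣_) (regroup x y u v) (Signed.∣m∣n⇒∣m-n x≡y u≡v))
    where
    regroup : ∀ x y u v → (x - y) - (u - v) ≡ (x - u) - (y - v)
    regroup = solve-∀

  ∑-mod : ∀ {N} {f g e : Fin N → ℕ} → (∀ j → + f j ≡ + g j ℤ.+ + e j mod n) →
    + ∑ f ≡ + ∑ g ℤ.+ + ∑ e mod n
  ∑-mod {zero}              _        = mod-reflexive refl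
  ∑-mod {suc N} {f} {g} {e} termwise = mod-cong (sym (ℤₚ.pos-+ (f zero) (∑ (f ∘ suc)))) regroup
    (mod-+ (termwise zero) (∑-mod (termwise ∘ suc)))
    where
    interchange : ∀ a b c d → (a ℤ.+ b) ℤ.+ (c ℤ.+ d) ≡ (a ℤ.+ c) ℤ.+ (b ℤ.+ d)
    interchange = solve-∀
    regroup : (+ g zero ℤ.+ + e zero) ℤ.+ (+ ∑ (g ∘ suc) ℤ.+ + ∑ (e ∘ suc)) ≡ + ∑ g ℤ.+ + ∑ e
    regroup = trans (interchange (+ g zero) (+ e zero) (+ ∑ (g ∘ suc)) (+ ∑ (e ∘ suc)))
      (sym (cong₂ ℤ._+_ (ℤₚ.pos-+ (g zero) (∑ (g ∘ suc))) (ℤₚ.pos-+ (e zero) (∑ (e ∘ suc)))))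

mod-∣ : ∀ {d n x y} → d ∣ℕ n → x ≡ y mod n → x ≡ y mod d
mod-∣ (ℕdivides q n≡qd) (mod-intro n∣x-y) =
  mod-intro (Signed.∣-trans (Signed.divides (+ q) (trans (cong +_ n≡qd) (ℤₚ.pos-* q _))) n∣x-y)

minuend-exchange : ∀ {x′ x y v v′ : ℤ} → x′ ℤ.+ v ≡ x ℤ.+ v′ → x′ - y ≡ (x - y) ℤ.+ (v′ - v)
minuend-exchange {x′} {x} {y} {v} {v′} e = begin
  x′ - y                 ≡⟨ add-sub x′ y v ⟩
  ((x′ ℤ.+ v) - y) - v   ≡⟨ cong (λ s → (s - y) - v) e ⟩
  ((x ℤ.+ v′) - y) - v   ≡⟨ regroup x y v v′ ⟩
  (x - y) ℤ.+ (v′ - v)   ∎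
  where
  open ≡-Reasoning
  add-sub : ∀ x y v → x - y ≡ ((x ℤ.+ v) - y) - v
  add-sub = solve-∀
  regroup : ∀ x y v v′ → ((x ℤ.+ v′) - y) - v ≡ (x - y) ℤ.+ (v′ - v)
  regroup = solve-∀

subtrahend-exchange : ∀ {x y′ y v v′ : ℤ} → y′ ℤ.+ v ≡ y ℤ.+ v′ → x - y′ ≡ (x - y) ℤ.+ (v - v′)
subtrahend-exchange {x} {y′} {y} {v} {v′} e = begin
  x - y′                 ≡⟨ add-sub x y′ v ⟩
  (x ℤ.+ v) - (y′ ℤ.+ v) ≡⟨ cong (λ s → (x ℤ.+ v) - s) e ⟩
  (x ℤ.+ v) - (y ℤ.+ v′) ≡⟨ regroup x y v v′ ⟩
  (x - y) ℤ.+ (v - v′)   ∎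
  where
  open ≡-Reasoning
  add-sub : ∀ x y v → x - y ≡ (x ℤ.+ v) - (y ℤ.+ v)
  add-sub = solve-∀
  regroup : ∀ x y v v′ → (x ℤ.+ v) - (y ℤ.+ v′) ≡ (x - y) ℤ.+ (v - v′)
  regroup = solve-∀

odd-step : ∀ x (u w : ℕ) → w ≡ suc u ⊎ u ≡ suc w → x ℤ.+ (+ w - + u) ≡ x ℤ.+ + 1 mod 2
odd-step x u _ (inj₁ refl) = mod-reflexive (cong (λ d → x ℤ.+ d) (up (+ u)))
  where
  up : ∀ u → (+ 1 ℤ.+ u) - u ≡ + 1
  up = solve-∀
odd-step x _ w (inj₂ refl) = mod-intro (Signed.divides (ℤ.- + 1) (down x (+ w)))
  where
  down : ∀ x w → (x ℤ.+ (w - (+ 1 ℤ.+ w))) - (x ℤ.+ + 1) ≡ ℤ.- + 1 ℤ.* + 2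
  down = solve-∀

mod-2-odd : ∀ {x t} → x ≡ t mod 2 → ¬ x ≡ t ℤ.+ + 1 mod 2
mod-2-odd {x} {t} x≡t x≡t+1 = 2∤1 (subst (2 ∣ℕ_) (cong ℤ.∣_∣ (minus-one t))
  (Signed.∣⇒∣ᵤ (divides-difference (mod-trans (mod-sym x≡t) x≡t+1))))
  where
  minus-one : ∀ t → t - (t ℤ.+ + 1) ≡ ℤ.- + 1
  minus-one = solve-∀
  2∤1 : ¬ 2 ∣ℕ 1
  2∤1 2∣1 with ℕDiv.∣1⇒≡1 2∣1
  ... | ()

shift-by-even : ∀ t i → t ℤ.+ + (2 * i) ≡ t mod 2
shift-by-even t i = mod-intro (Signed.divides (+ i)
  (trans (cong (λ d → (t ℤ.+ d) - t) (ℤₚ.pos-* 2 i)) (cancel t (+ i))))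
  where
  cancel : ∀ t i → (t ℤ.+ + 2 ℤ.* i) - t ≡ i ℤ.* + 2
  cancel = solve-∀

∣2d⇒2d≡n : ∀ {n d} → 0 < d → d < n → n ∣ℕ 2 * d → 2 * d ≡ n
∣2d⇒2d≡n 0<d d<n (ℕdivides zero 2d≡0)          = ⊥-elim (ℕₚ.<⇒≢ (ℕₚ.*-monoʳ-< 2 0<d) (sym 2d≡0))
∣2d⇒2d≡n {n} 0<d d<n (ℕdivides (suc zero) 2d≡n) = trans 2d≡n (ℕₚ.+-identityʳ n)
∣2d⇒2d≡n {n} {d} 0<d d<n (ℕdivides (suc (suc q)) 2d≡) =
  ⊥-elim (ℕₚ.<⇒≱ (ℕₚ.*-monoʳ-< 2 d<n) (begin
    2 * n              ≡⟨ cong (λ k → n + k) (ℕₚ.+-identityʳ n) ⟩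
    n + n              ≤⟨ ℕₚ.+-monoʳ-≤ n (ℕₚ.m≤m+n n (q * n)) ⟩
    suc (suc q) * n    ≡⟨ 2d≡ ⟨
    2 * d              ∎))
  where open ℕₚ.≤-Reasoning

even-or-odd : ∀ n → ∃ (λ h → n ≡ 2 * h) ⊎ ∃ (λ h → n ≡ suc (2 * h))
even-or-odd zero    = inj₁ (0 , refl)
even-or-odd (suc n) with even-or-odd n
... | inj₁ (h , n≡2h)   = inj₂ (h , cong suc n≡2h)
... | inj₂ (h , n≡2h+1) = inj₁ (suc h , trans (cong suc n≡2h+1) (sym (ℕₚ.*-suc 2 h)))

-- Permutations

≉⇒Distinct : ∀ {n} {σ ρ : Permutation′ n} → ¬ σ ≈ ρ → Distinct σ ρ
≉⇒Distinct {n} {σ} {ρ} = ¬∀⟶∃¬ n _ (λ i → σ ⟨$⟩ʳ i ≟ ρ ⟨$⟩ʳ i)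

Distinct⇒≉ : ∀ {n} {σ ρ : Permutation′ n} → Distinct σ ρ → ¬ σ ≈ ρ
Distinct⇒≉ (i , σi≢ρi) σ≈ρ = σi≢ρi (σ≈ρ i)

map-Distinct : ∀ {n} (f : Permutation′ n → Permutation′ n) → (∀ {σ ρ} → f σ ≈ f ρ → σ ≈ ρ) →
  ∀ {L} → AllPairs Distinct L → AllPairs Distinct (map f L)
map-Distinct f f-cancel = AllPairsₚ.map⁺ ∘ AllPairs.map (λ {σ} {ρ} σ#ρ →
  ≉⇒Distinct {σ = f σ} {f ρ} (Distinct⇒≉ {σ = σ} {ρ} σ#ρ ∘ f-cancel))

map-Distinct-on : ∀ {A : Set} {n} {P : A → Set} {R : A → A → Set} (f : A → Permutation′ n) →
  (∀ {x y} → P x → P y → R x y → ¬ f x ≈ f y) →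
  ∀ {xs} → All P xs → AllPairs R xs → AllPairs Distinct (map f xs)
map-Distinct-on f separated pxs rxs = AllPairsₚ.map⁺
  (allPairs-restrict (λ {x} {y} px py rxy → ≉⇒Distinct {σ = f x} {f y} (separated px py rxy)) pxs rxs)

⟨$⟩ˡ-cong : ∀ {n} {σ ρ : Permutation′ n} → σ ≈ ρ → ∀ u → σ ⟨$⟩ˡ u ≡ ρ ⟨$⟩ˡ u
⟨$⟩ˡ-cong {σ = σ} {ρ} σ≈ρ u = begin
  σ ⟨$⟩ˡ u                       ≡⟨ cong (σ ⟨$⟩ˡ_) (inverseʳ ρ) ⟨
  σ ⟨$⟩ˡ (ρ ⟨$⟩ʳ (ρ ⟨$⟩ˡ u))      ≡⟨ cong (σ ⟨$⟩ˡ_) (σ≈ρ (ρ ⟨$⟩ˡ u)) ⟨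
  σ ⟨$⟩ˡ (σ ⟨$⟩ʳ (ρ ⟨$⟩ˡ u))      ≡⟨ inverseˡ σ ⟩
  ρ ⟨$⟩ˡ u                       ∎
  where open ≡-Reasoning

equal-either-or-neither : ∀ {n} (u x y : Fin n) → u ≡ x ⊎ u ≡ y ⊎ u ≢ x × u ≢ y
equal-either-or-neither u x y with u ≟ x | u ≟ y
... | yes u≡x | _       = inj₁ u≡x
... | no  _   | yes u≡y = inj₂ (inj₁ u≡y)
... | no  u≢x | no  u≢y = inj₂ (inj₂ (u≢x , u≢y))

transpose-applyˡ : ∀ {n} (i j : Fin n) → PC.transpose i j i ≡ j
transpose-applyˡ i j rewrite dec-true (i ≟ i) refl = refl

transpose-applyʳ : ∀ {n} (i j : Fin n) → PC.transpose i j j ≡ i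
transpose-applyʳ i j with j ≟ i
... | yes j≡i = j≡i
... | no  _   rewrite dec-true (j ≟ j) refl = refl

transpose-apply-≢ : ∀ {n} {i j k : Fin n} → k ≢ i → k ≢ j → PC.transpose i j k ≡ k
transpose-apply-≢ {i = i} {j} {k} k≢i k≢j rewrite dec-false (k ≟ i) k≢i | dec-false (k ≟ j) k≢j = refl

∘ₚ-cancelˡ : ∀ {n} (π : Permutation′ n) {σ ρ : Permutation′ n} → π ∘ₚ σ ≈ π ∘ₚ ρ → σ ≈ ρ
∘ₚ-cancelˡ π {σ} {ρ} πσ≈πρ i =
  subst (λ j → σ ⟨$⟩ʳ j ≡ ρ ⟨$⟩ʳ j) (inverseʳ π) (πσ≈πρ (π ⟨$⟩ˡ i))

∘ₚ-cancelʳ : ∀ {n} (π : Permutation′ n) {σ ρ : Permutation′ n} → σ ∘ₚ π ≈ ρ ∘ₚ π → σ ≈ ρ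
∘ₚ-cancelʳ π σπ≈ρπ i = trans (sym (inverseˡ π)) (trans (cong (π ⟨$⟩ˡ_) (σπ≈ρπ i)) (inverseˡ π))

remove-Distinct : ∀ {m} {π ρ : Permutation′ (suc m)} → π ⟨$⟩ʳ zero ≡ ρ ⟨$⟩ʳ zero →
  Distinct π ρ → Distinct (remove zero π) (remove zero ρ)
remove-Distinct π₀≡ρ₀ (zero  , π₀≢ρ₀) = ⊥-elim (π₀≢ρ₀ π₀≡ρ₀)
remove-Distinct π₀≡ρ₀ (suc j , πj≢ρj) = j , πj≢ρj ∘ punchOut-injective′ π₀≡ρ₀ _ _
  where
  punchOut-injective′ : ∀ {m} {i i′ x y : Fin (suc m)} → i ≡ i′ →
    (i≢x : i ≢ x) (i′≢y : i′ ≢ y) → punchOut i≢x ≡ punchOut i′≢y → x ≡ y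
  punchOut-injective′ refl = punchOut-injective

length-≤-! : ∀ n (L : List (Permutation′ n)) → AllPairs Distinct L → length L ≤ n !
length-≤-! zero    []          _                      = z≤n
length-≤-! zero    (_ ∷ [])    _                      = s≤s z≤n
length-≤-! zero    (_ ∷ _ ∷ _) (((() , _) ∷ _) ∷ _)
length-≤-! (suc m) L           distinct = length-≤-fibres value₀ L fibre-bound
  where
  value₀ : Permutation′ (suc m) → Fin (suc m)
  value₀ π = π ⟨$⟩ʳ zero

  fibre-bound : ∀ c → length (fibre value₀ c L) ≤ m !
  fibre-bound c = begin
    length (fibre value₀ c L)                    ≡⟨ length-map (remove zero) (fibre value₀ c L) ⟨
    length (map (remove zero) (fibre value₀ c L)) ≤⟨ length-≤-! m _ removed-distinct ⟩
    m !                                           ∎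
    where
    open ℕₚ.≤-Reasoning
    removed-distinct : AllPairs Distinct (map (remove zero) (fibre value₀ c L))
    removed-distinct = AllPairsₚ.map⁺ (allPairs-restrict {R = Distinct}
      (λ {π} {ρ} π₀≡c ρ₀≡c → remove-Distinct {π = π} {ρ} (trans π₀≡c (sym ρ₀≡c)))
      (Allₚ.all-filter (λ π → value₀ π ≟ c) L)
      (AllPairsₚ.filter⁺ (λ π → value₀ π ≟ c) distinct))

module _ {m : ℕ} where

  pred-mod : Fin (suc m) → Fin (suc m)
  pred-mod zero    = fromℕ m
  pred-mod (suc j) = inject₁ j

  suc-mod : Fin (suc m) → Fin (suc m)
  suc-mod i with m ℕₚ.≟ toℕ i
  ... | yes _   = zero
  ... | no  m≢i = suc (lower₁ i m≢i)

  suc-mod-pred-mod : ∀ j → suc-mod (pred-mod j) ≡ j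
  suc-mod-pred-mod zero with m ℕₚ.≟ toℕ (fromℕ m)
  ... | yes _   = refl
  ... | no  m≢m = ⊥-elim (m≢m (sym (toℕ-fromℕ m)))
  suc-mod-pred-mod (suc j) with m ℕₚ.≟ toℕ (inject₁ j)
  ... | yes m≡j = ⊥-elim (toℕ-inject₁-≢ j m≡j)
  ... | no  m≢j = cong suc (lower₁-inject₁′ j m≢j)

  pred-mod-suc-mod : ∀ i → pred-mod (suc-mod i) ≡ i
  pred-mod-suc-mod i with m ℕₚ.≟ toℕ i
  ... | yes m≡i = toℕ-injective (trans (toℕ-fromℕ m) m≡i)
  ... | no  m≢i = inject₁-lower₁ i m≢i

  toℕ-suc-mod : ∀ i → toℕ (suc-mod i) ≡ suc (toℕ i) ⊎ (toℕ (suc-mod i) ≡ 0 × toℕ i ≡ m)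
  toℕ-suc-mod i with m ℕₚ.≟ toℕ i
  ... | yes m≡i = inj₂ (refl , sym m≡i)
  ... | no  m≢i = inj₁ (cong suc (toℕ-lower₁ i m≢i))

  rotate : Permutation′ (suc m)
  rotate = permutation suc-mod pred-mod suc-mod-pred-mod pred-mod-suc-mod

-- (σ ∘ₚ π) ⟨$⟩ʳ i = π ⟨$⟩ʳ (σ ⟨$⟩ʳ i): composing on the right acts on values, on the left on positions.
rotate^ : ∀ {m} → ℕ → Permutation′ (suc m) → Permutation′ (suc m)
rotate^ zero    σ = σ
rotate^ (suc i) σ = rotate^ i σ ∘ₚ rotate

rotate^-cancel : ∀ {m} i {σ ρ : Permutation′ (suc m)} → rotate^ i σ ≈ rotate^ i ρ → σ ≈ ρ
rotate^-cancel zero    σ≈ρ = σ≈ρ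
rotate^-cancel (suc i) {σ} {ρ} σ≈ρ = rotate^-cancel i (∘ₚ-cancelʳ rotate {rotate^ i σ} {rotate^ i ρ} σ≈ρ)

rotations : ∀ {m} → ℕ → List (Permutation′ (suc m)) → List (Permutation′ (suc m))
rotations zero    L = []
rotations (suc r) L = rotations r L ++ map (rotate^ r) L

length-rotations : ∀ {m} r (L : List (Permutation′ (suc m))) → length (rotations r L) ≡ r * length L
length-rotations zero    L = refl
length-rotations (suc r) L = begin
  length (rotations r L ++ map (rotate^ r) L)         ≡⟨ length-++ (rotations r L) ⟩
  length (rotations r L) + length (map (rotate^ r) L) ≡⟨ cong₂ _+_ (length-rotations r L)
                                                                  (length-map (rotate^ r) L) ⟩
  r * length L + length L                             ≡⟨ ℕₚ.+-comm (r * length L) (length L) ⟩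
  suc r * length L                                    ∎
  where open ≡-Reasoning

-- The statistic D

sumPos≡∑ : ∀ {n} (σ : Permutation′ n) lo hi →
  sumPos σ lo hi ≡ ∑[ j < n ] (if does (inRange? lo hi j) then val σ j else 0)
sumPos≡∑ {n} σ lo hi = sum-filter n (λ j → j) (λ j → T? (does (inRange? lo hi j))) (val σ)

D-cong : ∀ {n} a b {σ ρ : Permutation′ n} → σ ≈ ρ → D a b σ ≡ D a b ρ
D-cong a b {σ} {ρ} σ≈ρ = cong₂ (λ x y → + x - + y) (sumPos-cong 0 a) (sumPos-cong a (a + b))
  where
  sumPos-cong : ∀ lo hi → sumPos σ lo hi ≡ sumPos ρ lo hi
  sumPos-cong lo hi =
    cong sum (map-cong (cong (suc ∘ toℕ) ∘ σ≈ρ) (filterᵇ (λ j → does (inRange? lo hi j)) (allFin _)))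

module _ {m : ℕ} (σ : Permutation′ (suc m)) where

  val-rotate : ∀ j → + val (σ ∘ₚ rotate) j ≡ + val σ j ℤ.+ + 1 mod suc m
  val-rotate j with toℕ-suc-mod (σ ⟨$⟩ʳ j)
  ... | inj₁ next = mod-reflexive (cong (+_ ∘ suc) (trans next (ℕₚ.+-comm 1 (toℕ (σ ⟨$⟩ʳ j)))))
  ... | inj₂ (wraps , last) =
    mod-cong (cong (+_ ∘ suc) (sym wraps)) (cong (λ x → + suc x ℤ.+ + 1) (sym last))
      (mod-intro (Signed.divides (ℤ.- + 1) (wrap (+ suc m))))
    where
    wrap : ∀ N → + 1 - (N ℤ.+ + 1) ≡ ℤ.- + 1 ℤ.* N
    wrap = solve-∀

  sumPos-rotate : ∀ lo hi → hi ≤ suc m →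
    + sumPos (σ ∘ₚ rotate) lo hi ≡ + sumPos σ lo hi ℤ.+ + (hi ∸ lo) mod suc m
  sumPos-rotate lo hi hi≤n = mod-cong
    (cong +_ (sym (sumPos≡∑ (σ ∘ₚ rotate) lo hi)))
    (cong₂ (λ x y → + x ℤ.+ + y) (sym (sumPos≡∑ σ lo hi)) (∑-inRange (suc m) lo hi hi≤n))
    (∑-mod {f = λ j → if does (inRange? lo hi j) then val (σ ∘ₚ rotate) j else 0}
           {g = λ j → if does (inRange? lo hi j) then val σ j else 0}
           {e = λ j → if does (inRange? lo hi j) then 1 else 0}
           (λ j → masked (does (inRange? lo hi j)) j))
    where
    masked : ∀ b j → + (if b then val (σ ∘ₚ rotate) j else 0) ≡
                     + (if b then val σ j else 0) ℤ.+ + (if b then 1 else 0) mod suc m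
    masked true  j = val-rotate j
    masked false j = mod-reflexive refl

  D-rotate : ∀ a b → a + b ≤ suc m → D a b (σ ∘ₚ rotate) ≡ D a b σ ℤ.+ (+ a - + b) mod suc m
  D-rotate a b a+b≤n = mod-cong refl regroup
    (mod-- (sumPos-rotate 0 a (ℕₚ.≤-trans (ℕₚ.m≤m+n a b) a+b≤n)) (sumPos-rotate a (a + b) a+b≤n))
    where
    interchange : ∀ s₁ s₂ x y → (s₁ ℤ.+ x) - (s₂ ℤ.+ y) ≡ (s₁ - s₂) ℤ.+ (x - y)
    interchange = solve-∀
    regroup : (+ sumPos σ 0 a ℤ.+ + a) - (+ sumPos σ a (a + b) ℤ.+ + (a + b ∸ a)) ≡ D a b σ ℤ.+ (+ a - + b)
    regroup rewrite ℕₚ.m+n∸m≡n a b = interchange (+ sumPos σ 0 a) (+ sumPos σ a (a + b)) (+ a) (+ b)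

module _ {n} {σ σ′ : Permutation′ n} {p q : Fin n}
         (agree : ∀ j → j ≢ p → j ≢ q → σ′ ⟨$⟩ʳ j ≡ σ ⟨$⟩ʳ j) where

  sumPos-update : ∀ lo hi → hi ≤ toℕ q →
    sumPos σ′ lo hi + (if does (inRange? lo hi p) then val σ p else 0) ≡
    sumPos σ lo hi + (if does (inRange? lo hi p) then val σ′ p else 0)
  sumPos-update lo hi hi≤q = begin
    sumPos σ′ lo hi + masked σ p    ≡⟨ cong (_+ masked σ p) (sumPos≡∑ σ′ lo hi) ⟩
    ∑ (masked σ′) + masked σ p      ≡⟨ ∑-update (masked σ) (masked σ′) p agree-masked ⟩
    ∑ (masked σ) + masked σ′ p      ≡⟨ cong (_+ masked σ′ p) (sumPos≡∑ σ lo hi) ⟨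
    sumPos σ lo hi + masked σ′ p    ∎
    where
    open ≡-Reasoning
    masked : Permutation′ n → Fin n → ℕ
    masked π j = if does (inRange? lo hi j) then val π j else 0
    agree-masked : ∀ j → j ≢ p → masked σ′ j ≡ masked σ j
    agree-masked j j≢p with j ≟ q
    ... | yes refl rewrite dec-false (inRange? lo hi j) (λ (_ , j<hi) → ℕₚ.<⇒≱ j<hi hi≤q) = refl
    ... | no  j≢q  = cong (λ v → if does (inRange? lo hi j) then suc (toℕ v) else 0) (agree j j≢p j≢q)

  sumPos-update-inside : ∀ lo hi → lo ≤ toℕ p × toℕ p < hi → hi ≤ toℕ q →
    sumPos σ′ lo hi + val σ p ≡ sumPos σ lo hi + val σ′ p
  sumPos-update-inside lo hi p∈ hi≤q =
    subst (λ b → sumPos σ′ lo hi + (if b then val σ p else 0) ≡ sumPos σ lo hi + (if b then val σ′ p else 0))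
      (dec-true (inRange? lo hi p) p∈) (sumPos-update lo hi hi≤q)

  sumPos-update-outside : ∀ lo hi → ¬ (lo ≤ toℕ p × toℕ p < hi) → hi ≤ toℕ q →
    sumPos σ′ lo hi ≡ sumPos σ lo hi
  sumPos-update-outside lo hi p∉ hi≤q = ℕₚ.+-cancelʳ-≡ _ _ _
    (subst (λ b → sumPos σ′ lo hi + (if b then val σ p else 0) ≡ sumPos σ lo hi + (if b then val σ′ p else 0))
      (dec-false (inRange? lo hi p) p∉) (sumPos-update lo hi hi≤q))

  D-update : ∀ a b → toℕ p < a + b → a + b ≤ toℕ q →
    D a b σ′ ≡ D a b σ ℤ.+ (+ val σ′ p - + val σ p) ⊎
    D a b σ′ ≡ D a b σ ℤ.+ (+ val σ p - + val σ′ p)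
  D-update a b p<a+b a+b≤q with toℕ p ℕₚ.<? a
  ... | yes p<a = inj₁ (begin
    + sumPos σ′ 0 a - + sumPos σ′ a (a + b)   ≡⟨ cong (λ s → + sumPos σ′ 0 a - + s) second-unchanged ⟩
    + sumPos σ′ 0 a - + sumPos σ a (a + b)    ≡⟨ minuend-exchange {+ sumPos σ′ 0 a} {+ sumPos σ 0 a}
                                                   {+ sumPos σ a (a + b)} {+ val σ p} {+ val σ′ p}
                                                   (cong +_ first-updated) ⟩
    D a b σ ℤ.+ (+ val σ′ p - + val σ p)      ∎)
    where
    open ≡-Reasoning
    first-updated : sumPos σ′ 0 a + val σ p ≡ sumPos σ 0 a + val σ′ p
    first-updated = sumPos-update-inside 0 a (z≤n , p<a)
      (ℕₚ.≤-trans (ℕₚ.m≤m+n a b) a+b≤q)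
    second-unchanged : sumPos σ′ a (a + b) ≡ sumPos σ a (a + b)
    second-unchanged = sumPos-update-outside a (a + b)
      (λ (a≤p , _) → ℕₚ.<⇒≱ p<a a≤p) a+b≤q
  ... | no  a≮p = inj₂ (begin
    + sumPos σ′ 0 a - + sumPos σ′ a (a + b)   ≡⟨ cong (λ s → + s - + sumPos σ′ a (a + b)) first-unchanged ⟩
    + sumPos σ 0 a - + sumPos σ′ a (a + b)    ≡⟨ subtrahend-exchange {+ sumPos σ 0 a} {+ sumPos σ′ a (a + b)}
                                                   {+ sumPos σ a (a + b)} {+ val σ p} {+ val σ′ p}
                                                   (cong +_ second-updated) ⟩
    D a b σ ℤ.+ (+ val σ p - + val σ′ p)      ∎)
    where
    open ≡-Reasoning
    first-unchanged : sumPos σ′ 0 a ≡ sumPos σ 0 a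
    first-unchanged = sumPos-update-outside 0 a
      (λ (_ , p<a) → a≮p p<a) (ℕₚ.≤-trans (ℕₚ.m≤m+n a b) a+b≤q)
    second-updated : sumPos σ′ a (a + b) + val σ p ≡ sumPos σ a (a + b) + val σ′ p
    second-updated = sumPos-update-inside a (a + b) (ℕₚ.≮⇒≥ a≮p , p<a+b) a+b≤q

  D-update-parity : ∀ a b → toℕ p < a + b → a + b ≤ toℕ q →
    val σ′ p ≡ suc (val σ p) ⊎ val σ p ≡ suc (val σ′ p) → D a b σ′ ≡ D a b σ ℤ.+ + 1 mod 2
  D-update-parity a b p<a+b a+b≤q adjacent with D-update a b p<a+b a+b≤q
  ... | inj₁ D′≡ = mod-cong (sym D′≡) refl (odd-step (D a b σ) (val σ p) (val σ′ p) adjacent)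
  ... | inj₂ D′≡ = mod-cong (sym D′≡) refl (odd-step (D a b σ) (val σ′ p) (val σ p) (swap adjacent))

module _ {m : ℕ} (a : ℕ) (2≤a : 2 ≤ a) (window : a + (a ∸ 2) ≤ suc m) where

  D-rotate-by-2 : ∀ (σ : Permutation′ (suc m)) →
    D a (a ∸ 2) (σ ∘ₚ rotate) ≡ D a (a ∸ 2) σ ℤ.+ + 2 mod suc m
  D-rotate-by-2 σ = mod-cong refl (cong (λ d → D a (a ∸ 2) σ ℤ.+ d) (a-[a∸2] 2≤a))
    (D-rotate σ a (a ∸ 2) window)
    where
    a-[a∸2] : ∀ {a} → 2 ≤ a → + a - + (a ∸ 2) ≡ + 2
    a-[a∸2] {suc zero}    (s≤s ())
    a-[a∸2] {suc (suc c)} _ = cancel (+ c)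
      where
      cancel : ∀ c → (+ 2 ℤ.+ c) - c ≡ + 2
      cancel = solve-∀

  D-rotate^ : ∀ i (σ : Permutation′ (suc m)) →
    D a (a ∸ 2) (rotate^ i σ) ≡ D a (a ∸ 2) σ ℤ.+ + (2 * i) mod suc m
  D-rotate^ zero    σ = mod-reflexive (sym (ℤₚ.+-identityʳ _))
  D-rotate^ (suc i) σ = mod-cong refl
    (trans (regroup (D a (a ∸ 2) σ) (+ (2 * i))) (cong (λ k → D a (a ∸ 2) σ ℤ.+ + k) (sym (ℕₚ.*-suc 2 i))))
    (mod-trans (D-rotate-by-2 (rotate^ i σ)) (mod-+ (D-rotate^ i σ) (mod-reflexive refl)))
    where
    regroup : ∀ x y → (x ℤ.+ y) ℤ.+ + 2 ≡ x ℤ.+ (+ 2 ℤ.+ y)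
    regroup = solve-∀

  module _ (t : ℤ) where

    Class : ℕ → Permutation′ (suc m) → Set
    Class i σ = D a (a ∸ 2) σ ≡ t ℤ.+ + (2 * i) mod suc m

    Class-rotate^ : ∀ {σ} r → D a (a ∸ 2) σ ≡ t mod suc m → Class r (rotate^ r σ)
    Class-rotate^ {σ} r D≡t = mod-trans (D-rotate^ r σ) (mod-+ D≡t (mod-reflexive refl))

    Class-≈⇒∣ : ∀ {i j σ ρ} → i < j → Class i σ → Class j ρ → σ ≈ ρ → suc m ∣ℕ 2 * (j ∸ i)
    Class-≈⇒∣ {i} {j} {σ} {ρ} i<j σ∈i ρ∈j σ≈ρ = Signed.∣⇒∣ᵤ (subst (+ suc m Signed.∣_) difference
      (divides-difference (mod-trans (mod-sym ρ∈j) (mod-cong (D-cong a (a ∸ 2) {σ} {ρ} σ≈ρ) refl σ∈i))))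
      where
      cancel : ∀ t x y → (t ℤ.+ (x ℤ.+ y)) - (t ℤ.+ x) ≡ y
      cancel = solve-∀
      difference : (t ℤ.+ + (2 * j)) - (t ℤ.+ + (2 * i)) ≡ + (2 * (j ∸ i))
      difference = begin
        (t ℤ.+ + (2 * j)) - (t ℤ.+ + (2 * i))
          ≡⟨ cong (λ k → (t ℤ.+ + (2 * k)) - (t ℤ.+ + (2 * i))) (sym (ℕₚ.m+[n∸m]≡n (ℕₚ.<⇒≤ i<j))) ⟩
        (t ℤ.+ + (2 * (i + (j ∸ i)))) - (t ℤ.+ + (2 * i))
          ≡⟨ cong (λ k → (t ℤ.+ + k) - (t ℤ.+ + (2 * i))) (ℕₚ.*-distribˡ-+ 2 i (j ∸ i)) ⟩
        (t ℤ.+ (+ (2 * i) ℤ.+ + (2 * (j ∸ i)))) - (t ℤ.+ + (2 * i))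
          ≡⟨ cancel t (+ (2 * i)) (+ (2 * (j ∸ i))) ⟩
        + (2 * (j ∸ i))
          ∎
        where open ≡-Reasoning

    rotations-Class : ∀ {L} → All (λ σ → D a (a ∸ 2) σ ≡ t mod suc m) L →
      ∀ r → All (λ σ → ∃ λ i → i < r × Class i σ) (rotations r L)
    rotations-Class L≡t zero    = []
    rotations-Class L≡t (suc r) = Allₚ.++⁺
      (All.map (λ (i , i<r , σ∈i) → i , ℕₚ.m≤n⇒m≤1+n i<r , σ∈i) (rotations-Class L≡t r))
      (Allₚ.map⁺ (All.map (λ D≡t → r , ℕₚ.n<1+n r , Class-rotate^ r D≡t) L≡t))

    rotations-distinct : ∀ {R L} → (∀ d → 0 < d → d < R → ¬ suc m ∣ℕ 2 * d) →
      AllPairs Distinct L → All (λ σ → D a (a ∸ 2) σ ≡ t mod suc m) L →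
      ∀ r → r ≤ R → AllPairs Distinct (rotations r L)
    rotations-distinct no-wrap distinct L≡t zero    _   = []
    rotations-distinct no-wrap distinct L≡t (suc r) r<R = AllPairsₚ.++⁺
      (rotations-distinct no-wrap distinct L≡t r (ℕₚ.<⇒≤ r<R))
      (map-Distinct (rotate^ r) (λ {σ} {ρ} → rotate^-cancel r {σ} {ρ}) distinct)
      (All.map (λ {σ} (i , i<r , σ∈i) → Allₚ.map⁺ (All.map (λ {ρ} D≡t → ≉⇒Distinct {σ = σ} {rotate^ r ρ}
          (no-wrap (r ∸ i) (ℕₚ.m<n⇒0<n∸m i<r) (ℕₚ.≤-<-trans (ℕₚ.m∸n≤m r i) r<R)
            ∘ Class-≈⇒∣ {σ = σ} {rotate^ r ρ} i<r σ∈i (Class-rotate^ {ρ} r D≡t))) L≡t))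
        (rotations-Class L≡t r))

-- Pairs of values

partner : ℕ → ℕ
partner zero          = 1
partner (suc zero)    = 0
partner (suc (suc x)) = suc (suc (partner x))

partner-involutive : ∀ x → partner (partner x) ≡ x
partner-involutive zero          = refl
partner-involutive (suc zero)    = refl
partner-involutive (suc (suc x)) = cong (λ y → suc (suc y)) (partner-involutive x)

partner-adjacent : ∀ x → partner x ≡ suc x ⊎ x ≡ suc (partner x)
partner-adjacent zero          = inj₁ refl
partner-adjacent (suc zero)    = inj₂ refl
partner-adjacent (suc (suc x)) with partner-adjacent x
... | inj₁ up   = inj₁ (cong (λ y → suc (suc y)) up)
... | inj₂ down = inj₂ (cong (λ y → suc (suc y)) down)

partner-≢ : ∀ x → partner x ≢ x
partner-≢ x eq with partner-adjacent x
... | inj₁ up   = ℕₚ.1+n≢n (trans (sym up) eq)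
... | inj₂ down = ℕₚ.1+n≢n (sym (trans down (cong suc eq)))

partner-< : ∀ h x → x < h + h → partner x < h + h
partner-< (suc h) zero          _   = s≤s (ℕₚ.≤-trans (s≤s z≤n) (ℕₚ.≤-reflexive (sym (ℕₚ.+-suc h h))))
partner-< (suc h) (suc zero)    _   = s≤s z≤n
partner-< (suc h) (suc (suc x)) x<n = s≤s (subst (suc (suc (partner x)) ≤_) (sym (ℕₚ.+-suc h h))
  (s≤s (partner-< h x (ℕₚ.≤-pred (subst (suc (suc x) ≤_) (ℕₚ.+-suc h h) (ℕₚ.≤-pred x<n))))))

xor-true : ∀ {x y} → x xor y ≡ true → x ≡ true × y ≡ false ⊎ x ≡ false × y ≡ true
xor-true {true}  {false} _ = inj₁ (refl , refl)
xor-true {false} {true}  _ = inj₂ (refl , refl)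

xor-false : ∀ {x y} → x xor y ≡ false → x ≡ y
xor-false {true}  {true}  _ = refl
xor-false {false} {false} _ = refl

module Parity {m h : ℕ} (n≡h+h : suc m ≡ h + h) (a b : ℕ) where

  partnerᶠ : Fin (suc m) → Fin (suc m)
  partnerᶠ x = fromℕ< (subst (partner (toℕ x) <_) (sym n≡h+h)
    (partner-< h (toℕ x) (subst (toℕ x <_) n≡h+h (toℕ<n x))))

  toℕ-partnerᶠ : ∀ x → toℕ (partnerᶠ x) ≡ partner (toℕ x)
  toℕ-partnerᶠ x = toℕ-fromℕ< _

  partnerᶠ-involutive : ∀ x → partnerᶠ (partnerᶠ x) ≡ x
  partnerᶠ-involutive x = toℕ-injective (begin
    toℕ (partnerᶠ (partnerᶠ x)) ≡⟨ toℕ-partnerᶠ (partnerᶠ x) ⟩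
    partner (toℕ (partnerᶠ x))  ≡⟨ cong partner (toℕ-partnerᶠ x) ⟩
    partner (partner (toℕ x))   ≡⟨ partner-involutive (toℕ x) ⟩
    toℕ x                       ∎)
    where open ≡-Reasoning

  partnerᶠ-swap : ∀ {u v} → partnerᶠ u ≡ v → u ≡ partnerᶠ v
  partnerᶠ-swap {u} refl = sym (partnerᶠ-involutive u)

  partnerᶠ-≢ : ∀ x → partnerᶠ x ≢ x
  partnerᶠ-≢ x eq = partner-≢ (toℕ x) (trans (sym (toℕ-partnerᶠ x)) (cong toℕ eq))

  partnerᶠ-adjacent : ∀ x → toℕ (partnerᶠ x) ≡ suc (toℕ x) ⊎ toℕ x ≡ suc (toℕ (partnerᶠ x))
  partnerᶠ-adjacent x rewrite toℕ-partnerᶠ x = partner-adjacent (toℕ x)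

  left : Fin (suc m) → Bool
  left j = toℕ j <ᵇ a + b

  splits : Permutation′ (suc m) → Fin (suc m) → Bool
  splits σ x = left (σ ⟨$⟩ˡ x) xor left (σ ⟨$⟩ˡ partnerᶠ x)

  Closed : Permutation′ (suc m) → Set
  Closed σ = ∀ x → splits σ x ≡ false

  closed? : Decidable Closed
  closed? σ = all? (λ x → splits σ x Bool.≟ false)

  swapPair : Permutation′ (suc m) → Fin (suc m) → Permutation′ (suc m)
  swapPair σ x = σ ∘ₚ transpose x (partnerᶠ x)

  flipAt : Maybe (Fin (suc m)) → Permutation′ (suc m) → Permutation′ (suc m)
  flipAt nothing  σ = σ
  flipAt (just x) σ = swapPair σ x

  -- Exchanging the values of a pair does not change which pairs are split, so the first split pair
  -- of flip σ is that of σ; this makes flip injective.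
  flip : Permutation′ (suc m) → Permutation′ (suc m)
  flip σ = flipAt (firstWhere (splits σ)) σ

  transpose-pair : ∀ x u → let τ = PC.transpose (partnerᶠ x) x in
    τ u ≡ u × τ (partnerᶠ u) ≡ partnerᶠ u ⊎ τ u ≡ partnerᶠ u × τ (partnerᶠ u) ≡ u
  transpose-pair x u with equal-either-or-neither u x (partnerᶠ x)
  ... | inj₁ refl = inj₂ (transpose-applyʳ (partnerᶠ u) u , transpose-applyˡ (partnerᶠ u) u)
  ... | inj₂ (inj₁ refl) = inj₂
    (trans (transpose-applyˡ (partnerᶠ x) x) (partnerᶠ-swap refl) ,
     trans (cong (PC.transpose (partnerᶠ x) x) (partnerᶠ-involutive x)) (transpose-applyʳ (partnerᶠ x) x))
  ... | inj₂ (inj₂ (u≢x , u≢x′)) = inj₁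
    (transpose-apply-≢ u≢x′ u≢x ,
     transpose-apply-≢ (λ e → u≢x (trans (partnerᶠ-swap e) (partnerᶠ-involutive x))) (u≢x′ ∘ partnerᶠ-swap))

  splits-swapPair : ∀ σ x → splits (swapPair σ x) ≗ splits σ
  splits-swapPair σ x u with transpose-pair x u
  ... | inj₁ (fixed , fixed′) = cong₂ separated fixed fixed′
    where separated = λ i j → left (σ ⟨$⟩ˡ i) xor left (σ ⟨$⟩ˡ j)
  ... | inj₂ (moved , moved′) = trans (cong₂ separated moved moved′)
    (xor-comm (left (σ ⟨$⟩ˡ partnerᶠ u)) (left (σ ⟨$⟩ˡ u)))
    where separated = λ i j → left (σ ⟨$⟩ˡ i) xor left (σ ⟨$⟩ˡ j)

  splits-flipAt : ∀ mx σ → splits (flipAt mx σ) ≗ splits σ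
  splits-flipAt nothing  σ u = refl
  splits-flipAt (just x) σ u = splits-swapPair σ x u

  splits-cong : ∀ {σ ρ} → σ ≈ ρ → splits σ ≗ splits ρ
  splits-cong {σ} {ρ} σ≈ρ u = cong₂ (λ i j → left i xor left j)
    (⟨$⟩ˡ-cong {σ = σ} {ρ} σ≈ρ u) (⟨$⟩ˡ-cong {σ = σ} {ρ} σ≈ρ (partnerᶠ u))

  Closed-cong : ∀ {σ ρ} → σ ≈ ρ → Closed σ → Closed ρ
  Closed-cong {σ} {ρ} σ≈ρ closed x = trans (sym (splits-cong {σ} {ρ} σ≈ρ x)) (closed x)

  flipAt-cancel : ∀ mx {σ ρ} → flipAt mx σ ≈ flipAt mx ρ → σ ≈ ρ
  flipAt-cancel nothing  σ≈ρ = σ≈ρ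
  flipAt-cancel (just x) {σ} {ρ} σ≈ρ = ∘ₚ-cancelʳ (transpose x (partnerᶠ x)) {σ} {ρ} σ≈ρ

  flip-injective : ∀ {σ ρ} → flip σ ≈ flip ρ → σ ≈ ρ
  flip-injective {σ} {ρ} flipσ≈flipρ = flipAt-cancel (firstWhere (splits σ))
    (subst (λ mx → flip σ ≈ flipAt mx ρ) (sym same-first-split) flipσ≈flipρ)
    where
    same-first-split : firstWhere (splits σ) ≡ firstWhere (splits ρ)
    same-first-split = firstWhere-cong λ u → begin
      splits σ u        ≡⟨ splits-flipAt (firstWhere (splits σ)) σ u ⟨
      splits (flip σ) u ≡⟨ splits-cong {flip σ} {flip ρ} flipσ≈flipρ u ⟩
      splits (flip ρ) u ≡⟨ splits-flipAt (firstWhere (splits ρ)) ρ u ⟩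
      splits ρ u        ∎
      where open ≡-Reasoning

  left-true : ∀ {j} → left j ≡ true → toℕ j < a + b
  left-true {j} is-left = ℕₚ.<ᵇ⇒< (toℕ j) (a + b) (subst T (sym is-left) _)

  left-false : ∀ {j} → left j ≡ false → a + b ≤ toℕ j
  left-false is-right = ℕₚ.≮⇒≥ (λ j<k → subst T is-right (ℕₚ.<⇒<ᵇ j<k))

  module _ (σ : Permutation′ (suc m)) (x : Fin (suc m)) where

    private
      σ′ = swapPair σ x
      p  = σ ⟨$⟩ˡ x
      q  = σ ⟨$⟩ˡ partnerᶠ x

    swapPair-agree : ∀ j → j ≢ p → j ≢ q → σ′ ⟨$⟩ʳ j ≡ σ ⟨$⟩ʳ j
    swapPair-agree j j≢p j≢q = transpose-apply-≢ (j≢p ∘ position) (j≢q ∘ position)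
      where
      position : ∀ {v} → σ ⟨$⟩ʳ j ≡ v → j ≡ σ ⟨$⟩ˡ v
      position refl = sym (inverseˡ σ)

    swapPair-adjacent : ∀ {i u v} → σ′ ⟨$⟩ʳ i ≡ u → σ ⟨$⟩ʳ i ≡ v →
      toℕ u ≡ suc (toℕ v) ⊎ toℕ v ≡ suc (toℕ u) →
      val σ′ i ≡ suc (val σ i) ⊎ val σ i ≡ suc (val σ′ i)
    swapPair-adjacent refl refl (inj₁ up)   = inj₁ (cong suc up)
    swapPair-adjacent refl refl (inj₂ down) = inj₂ (cong suc down)

    swapPair-at-p : σ′ ⟨$⟩ʳ p ≡ partnerᶠ x
    swapPair-at-p = trans (cong (PC.transpose x (partnerᶠ x)) (inverseʳ σ)) (transpose-applyˡ x (partnerᶠ x))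

    swapPair-at-q : σ′ ⟨$⟩ʳ q ≡ x
    swapPair-at-q = trans (cong (PC.transpose x (partnerᶠ x)) (inverseʳ σ)) (transpose-applyʳ x (partnerᶠ x))

    swapPair-parity : splits σ x ≡ true → D a b σ′ ≡ D a b σ ℤ.+ + 1 mod 2
    swapPair-parity split with xor-true split
    ... | inj₁ (p-left , q-right) = D-update-parity {σ = σ} {σ′} {p} {q} swapPair-agree a b
      (left-true p-left) (left-false q-right)
      (swapPair-adjacent swapPair-at-p (inverseʳ σ) (partnerᶠ-adjacent x))
    ... | inj₂ (p-right , q-left) = D-update-parity {σ = σ} {σ′} {q} {p} (λ j j≢q j≢p → swapPair-agree j j≢p j≢q) a b
      (left-true q-left) (left-false p-right)
      (swapPair-adjacent swapPair-at-q (inverseʳ σ) (swap (partnerᶠ-adjacent x)))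

  flip-parity : ∀ {σ} → ¬ Closed σ → D a b (flip σ) ≡ D a b σ ℤ.+ + 1 mod 2
  flip-parity {σ} ¬closed = by-first-split (firstWhere (splits σ)) refl
    where
    by-first-split : ∀ mx → firstWhere (splits σ) ≡ mx → D a b (flipAt mx σ) ≡ D a b σ ℤ.+ + 1 mod 2
    by-first-split nothing  none  = ⊥-elim (¬closed (firstWhere-nothing {P = splits σ} none))
    by-first-split (just x) found = swapPair-parity σ x (firstWhere-just {P = splits σ} found)

  left-< : ∀ {j} → toℕ j < a + b → left j ≡ true
  left-< j<k = Equivalence.to T-≡ (ℕₚ.<⇒<ᵇ j<k)

  left-≥ : ∀ {j} → a + b ≤ toℕ j → left j ≡ false
  left-≥ k≤j = ¬-not (λ is-left → ℕₚ.<⇒≱ (left-true is-left) k≤j)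

  partnerPos : Permutation′ (suc m) → Fin (suc m) → Fin (suc m)
  partnerPos σ i = σ ⟨$⟩ˡ partnerᶠ (σ ⟨$⟩ʳ i)

  partnerPos-≢ : ∀ σ i → partnerPos σ i ≢ i
  partnerPos-≢ σ i pp≡i = partnerᶠ-≢ (σ ⟨$⟩ʳ i) (trans (sym (inverseʳ σ)) (cong (σ ⟨$⟩ʳ_) pp≡i))

  closed-partnerPos : ∀ {σ} → Closed σ → ∀ i → left (partnerPos σ i) ≡ left i
  closed-partnerPos {σ} closed i = sym (trans (cong left (sym (inverseˡ σ))) (xor-false (closed (σ ⟨$⟩ʳ i))))

  separated⇒¬closed : ∀ {ρ i j} → left i ≢ left j → ρ ⟨$⟩ʳ j ≡ partnerᶠ (ρ ⟨$⟩ʳ i) →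
    ¬ Closed ρ
  separated⇒¬closed {ρ} {i} {j} sides ρj≡ closed = sides (begin
    left i                 ≡⟨ closed-partnerPos {ρ} closed i ⟨
    left (partnerPos ρ i)  ≡⟨ cong (left ∘ (ρ ⟨$⟩ˡ_)) ρj≡ ⟨
    left (ρ ⟨$⟩ˡ (ρ ⟨$⟩ʳ j)) ≡⟨ cong left (inverseˡ ρ) ⟩
    left j                 ∎)
    where open ≡-Reasoning

  swapPos : Permutation′ (suc m) → Fin (suc m) → Fin (suc m) → Permutation′ (suc m)
  swapPos σ c v = transpose c v ∘ₚ σ

  swapPos-else : ∀ σ {c v i} → i ≢ c → i ≢ v → swapPos σ c v ⟨$⟩ʳ i ≡ σ ⟨$⟩ʳ i
  swapPos-else σ i≢c i≢v = cong (σ ⟨$⟩ʳ_) (transpose-apply-≢ i≢c i≢v)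

  sides-≢ : ∀ {i j} → left i ≢ left j → i ≢ j
  sides-≢ sides refl = sides refl

  opposite-sides : ∀ {i j} → left i ≡ true → left j ≡ false → left i ≢ left j
  opposite-sides i-left j-right i~j with trans (sym i-left) (trans i~j j-right)
  ... | ()

  swapPos-¬closed : ∀ {σ c v} → Closed σ → left c ≢ left v → ¬ Closed (swapPos σ c v)
  swapPos-¬closed {σ} {c} {v} closed sides = separated⇒¬closed {swapPos σ c v} {i} {v} i-sides (begin
    σ ⟨$⟩ʳ PC.transpose c v v        ≡⟨ cong (σ ⟨$⟩ʳ_) (transpose-applyʳ c v) ⟩
    σ ⟨$⟩ʳ c                        ≡⟨ partnerᶠ-involutive (σ ⟨$⟩ʳ c) ⟨
    partnerᶠ (partnerᶠ (σ ⟨$⟩ʳ c))   ≡⟨ cong partnerᶠ (inverseʳ σ) ⟨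
    partnerᶠ (σ ⟨$⟩ʳ i)              ≡⟨ cong partnerᶠ (swapPos-else σ i≢c (sides-≢ i-sides)) ⟨
    partnerᶠ (swapPos σ c v ⟨$⟩ʳ i)  ∎)
    where
    open ≡-Reasoning
    i = partnerPos σ c
    i-sides : left i ≢ left v
    i-sides = sides ∘ trans (sym (closed-partnerPos {σ} closed c))
    i≢c : i ≢ c
    i≢c = partnerPos-≢ σ c

  swapPos-injective : ∀ {σ ρ c v v′} → Closed σ → Closed ρ → left c ≢ left v → left c ≢ left v′ →
    swapPos σ c v ≈ swapPos ρ c v′ → v ≡ v′
  swapPos-injective {σ} {ρ} {c} {v} {v′} closedσ closedρ sides sides′ same with v ≟ v′
  ... | yes v≡v′ = v≡v′
  ... | no  v≢v′ = ⊥-elim (separated⇒¬closed {ρ} {i} {v} i-sides ρv≡ closedρ)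
    where
    open ≡-Reasoning
    i = partnerPos σ c
    i-sides : left i ≢ left v
    i-sides = sides ∘ trans (sym (closed-partnerPos {σ} closedσ c))
    i-sides′ : left i ≢ left v′
    i-sides′ = sides′ ∘ trans (sym (closed-partnerPos {σ} closedσ c))
    i≢c : i ≢ c
    i≢c = partnerPos-≢ σ c
    ρv≡ : ρ ⟨$⟩ʳ v ≡ partnerᶠ (ρ ⟨$⟩ʳ i)
    ρv≡ = begin
      ρ ⟨$⟩ʳ v                       ≡⟨ swapPos-else ρ (sides-≢ (sides ∘ sym)) v≢v′ ⟨
      swapPos ρ c v′ ⟨$⟩ʳ v          ≡⟨ same v ⟨
      σ ⟨$⟩ʳ PC.transpose c v v      ≡⟨ cong (σ ⟨$⟩ʳ_) (transpose-applyʳ c v) ⟩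
      σ ⟨$⟩ʳ c                       ≡⟨ partnerᶠ-involutive (σ ⟨$⟩ʳ c) ⟨
      partnerᶠ (partnerᶠ (σ ⟨$⟩ʳ c))  ≡⟨ cong partnerᶠ (inverseʳ σ) ⟨
      partnerᶠ (σ ⟨$⟩ʳ i)             ≡⟨ cong partnerᶠ (swapPos-else σ i≢c (sides-≢ i-sides)) ⟨
      partnerᶠ (swapPos σ c v ⟨$⟩ʳ i) ≡⟨ cong partnerᶠ (same i) ⟩
      partnerᶠ (swapPos ρ c v′ ⟨$⟩ʳ i) ≡⟨ cong partnerᶠ (swapPos-else ρ i≢c (sides-≢ i-sides′)) ⟩
      partnerᶠ (ρ ⟨$⟩ʳ i)             ∎

  module _ (0<k : 0 < a + b) (k<n : a + b < suc m) where

    k₀ : Fin (suc m)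
    k₀ = fromℕ< k<n

    left-zero : left zero ≡ true
    left-zero = left-< 0<k

    left-k₀ : left k₀ ≡ false
    left-k₀ = left-≥ (ℕₚ.≤-reflexive (sym (toℕ-fromℕ< k<n)))

    swapPos-disjoint : ∀ {σ ρ q p} → Closed σ → Closed ρ →
      left q ≡ false → σ ⟨$⟩ʳ q ≢ partnerᶠ (σ ⟨$⟩ʳ k₀) → left p ≡ true → p ≢ zero →
      ¬ swapPos σ zero q ≈ swapPos ρ k₀ p
    swapPos-disjoint {σ} {ρ} {q} {p} closedσ closedρ q-right σq≢ p-left p≢0 same with partnerPos σ q ≟ k₀
    ... | yes j≡k₀ = σq≢ (partnerᶠ-swap (trans (sym (inverseʳ σ)) (cong (σ ⟨$⟩ʳ_) j≡k₀)))
    ... | no  j≢k₀ = separated⇒¬closed {ρ} {zero} {j} (opposite-sides left-zero j-right) ρj≡ closedρ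
      where
      open ≡-Reasoning
      j = partnerPos σ q
      j-right : left j ≡ false
      j-right = trans (closed-partnerPos {σ} closedσ q) q-right
      ρj≡ : ρ ⟨$⟩ʳ j ≡ partnerᶠ (ρ ⟨$⟩ʳ zero)
      j≢p : j ≢ p
      j≢p = sides-≢ (opposite-sides p-left j-right) ∘ sym
      j≢0 : j ≢ zero
      j≢0 = sides-≢ (opposite-sides left-zero j-right) ∘ sym
      0≢k₀ : zero ≢ k₀
      0≢k₀ = sides-≢ (opposite-sides left-zero left-k₀)
      ρj≡ = begin
        ρ ⟨$⟩ʳ j                              ≡⟨ swapPos-else ρ j≢k₀ j≢p ⟨
        swapPos ρ k₀ p ⟨$⟩ʳ j                 ≡⟨ same j ⟨
        swapPos σ zero q ⟨$⟩ʳ j               ≡⟨ swapPos-else σ j≢0 (partnerPos-≢ σ q) ⟩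
        σ ⟨$⟩ʳ j                              ≡⟨ inverseʳ σ ⟩
        partnerᶠ (σ ⟨$⟩ʳ q)                    ≡⟨ cong (partnerᶠ ∘ (σ ⟨$⟩ʳ_)) (transpose-applyˡ zero q) ⟨
        partnerᶠ (swapPos σ zero q ⟨$⟩ʳ zero) ≡⟨ cong partnerᶠ (same zero) ⟩
        partnerᶠ (swapPos ρ k₀ p ⟨$⟩ʳ zero)   ≡⟨ cong partnerᶠ (swapPos-else ρ 0≢k₀ (p≢0 ∘ sym)) ⟩
        partnerᶠ (ρ ⟨$⟩ʳ zero)                 ∎

    -- The position holding the partner of σ(k₀) is excluded: swapping it with 0 can give a permutation
    -- that is also an image of the second kind.
    SwapsWithZero : Permutation′ (suc m) → Fin (suc m) → Set
    SwapsWithZero σ q = (a + b ≤ toℕ q × toℕ q < suc m) × σ ⟨$⟩ʳ q ≢ partnerᶠ (σ ⟨$⟩ʳ k₀)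

    swapsWithZero? : ∀ σ → Decidable (SwapsWithZero σ)
    swapsWithZero? σ q = inRange? (a + b) (suc m) q ×-dec ¬? (σ ⟨$⟩ʳ q ≟ partnerᶠ (σ ⟨$⟩ʳ k₀))

    SwapsWithK₀ : Fin (suc m) → Set
    SwapsWithK₀ p = 1 ≤ toℕ p × toℕ p < a + b

    swapsWithZero-right : ∀ σ {q} → SwapsWithZero σ q → left q ≡ false
    swapsWithZero-right σ ((k≤q , _) , _) = left-≥ k≤q

    swapsWithK₀-left : ∀ {p} → SwapsWithK₀ p → left p ≡ true
    swapsWithK₀-left (_ , p<k) = left-< p<k

    swapsWithK₀-≢0 : ∀ {p} → SwapsWithK₀ p → p ≢ zero
    swapsWithK₀-≢0 (1≤p , _) refl with 1≤p
    ... | ()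

    images : Permutation′ (suc m) → List (Permutation′ (suc m))
    images σ = map (swapPos σ zero) (filter (swapsWithZero? σ) (allFin (suc m)))
            ++ map (swapPos σ k₀) (filter (inRange? 1 (a + b)) (allFin (suc m)))

    IsImage : Permutation′ (suc m) → Permutation′ (suc m) → Set
    IsImage σ τ = (∃ λ q → SwapsWithZero σ q × τ ≡ swapPos σ zero q)
                ⊎ (∃ λ p → SwapsWithK₀ p × τ ≡ swapPos σ k₀ p)

    images-IsImage : ∀ σ → All (IsImage σ) (images σ)
    images-IsImage σ = Allₚ.++⁺
      (Allₚ.map⁺ (All.map (λ {q} swaps → inj₁ (q , swaps , refl))
        (Allₚ.all-filter (swapsWithZero? σ) (allFin (suc m)))))
      (Allₚ.map⁺ (All.map (λ {p} swaps → inj₂ (p , swaps , refl))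
        (Allₚ.all-filter (inRange? 1 (a + b)) (allFin (suc m)))))

    zero-sides : ∀ σ {q} → SwapsWithZero σ q → left zero ≢ left q
    zero-sides σ swaps = opposite-sides left-zero (swapsWithZero-right σ swaps)

    k₀-sides : ∀ {p} → SwapsWithK₀ p → left k₀ ≢ left p
    k₀-sides swaps = opposite-sides (swapsWithK₀-left swaps) left-k₀ ∘ sym

    images-¬closed : ∀ {σ τ} → Closed σ → IsImage σ τ → ¬ Closed τ
    images-¬closed {σ} closed (inj₁ (q , swaps , refl)) = swapPos-¬closed {σ} {zero} {q} closed (zero-sides σ swaps)
    images-¬closed {σ} closed (inj₂ (p , swaps , refl)) = swapPos-¬closed {σ} {k₀} {p} closed (k₀-sides swaps)

    images-disjoint : ∀ {σ ρ τ τ′} → Closed σ → Closed ρ → IsImage σ τ → IsImage ρ τ′ →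
      τ ≈ τ′ → σ ≈ ρ
    images-disjoint {σ} {ρ} closedσ closedρ (inj₁ (q , swaps , refl)) (inj₁ (q′ , swaps′ , refl)) same
      with swapPos-injective {σ} {ρ} {zero} {q} {q′} closedσ closedρ (zero-sides σ swaps) (zero-sides ρ swaps′) same
    ... | refl = ∘ₚ-cancelˡ (transpose zero q) {σ} {ρ} same
    images-disjoint {σ} {ρ} closedσ closedρ (inj₂ (p , swaps , refl)) (inj₂ (p′ , swaps′ , refl)) same
      with swapPos-injective {σ} {ρ} {k₀} {p} {p′} closedσ closedρ (k₀-sides swaps) (k₀-sides swaps′) same
    ... | refl = ∘ₚ-cancelˡ (transpose k₀ p) {σ} {ρ} same
    images-disjoint {σ} {ρ} closedσ closedρ (inj₁ (q , swaps , refl)) (inj₂ (p , swaps′ , refl)) same =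
      ⊥-elim (swapPos-disjoint {σ} {ρ} {q} {p} closedσ closedρ (swapsWithZero-right σ swaps) (proj₂ swaps)
        (swapsWithK₀-left swaps′) (swapsWithK₀-≢0 swaps′) same)
    images-disjoint {σ} {ρ} closedσ closedρ (inj₂ (p , swaps , refl)) (inj₁ (q , swaps′ , refl)) same =
      ⊥-elim (swapPos-disjoint {ρ} {σ} {q} {p} closedρ closedσ (swapsWithZero-right ρ swaps′) (proj₂ swaps′)
        (swapsWithK₀-left swaps) (swapsWithK₀-≢0 swaps) (sym ∘ same))

    images-distinct : ∀ {σ} → Closed σ → AllPairs Distinct (images σ)
    images-distinct {σ} closed = AllPairsₚ.++⁺
      (map-Distinct-on (swapPos σ zero) separate-zero-swaps
        (Allₚ.all-filter (swapsWithZero? σ) (allFin (suc m)))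
        (AllPairsₚ.filter⁺ (swapsWithZero? σ) allFin-distinct))
      (map-Distinct-on (swapPos σ k₀) separate-k₀-swaps
        (Allₚ.all-filter (inRange? 1 (a + b)) (allFin (suc m)))
        (AllPairsₚ.filter⁺ (inRange? 1 (a + b)) allFin-distinct))
      (Allₚ.map⁺ (All.map (λ {q} swaps → Allₚ.map⁺ (All.map (λ {p} swaps′ →
          ≉⇒Distinct {σ = swapPos σ zero q} {swapPos σ k₀ p}
            (swapPos-disjoint {σ} {σ} {q} {p} closed closed (swapsWithZero-right σ swaps) (proj₂ swaps)
              (swapsWithK₀-left swaps′) (swapsWithK₀-≢0 swaps′)))
          (Allₚ.all-filter (inRange? 1 (a + b)) (allFin (suc m)))))
        (Allₚ.all-filter (swapsWithZero? σ) (allFin (suc m)))))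
      where
      separate-zero-swaps : ∀ {q q′} → SwapsWithZero σ q → SwapsWithZero σ q′ → q ≢ q′ →
        ¬ swapPos σ zero q ≈ swapPos σ zero q′
      separate-zero-swaps {q} {q′} swaps swaps′ q≢q′ = q≢q′ ∘
        swapPos-injective {σ} {σ} {zero} {q} {q′} closed closed (zero-sides σ swaps) (zero-sides σ swaps′)
      separate-k₀-swaps : ∀ {p p′} → SwapsWithK₀ p → SwapsWithK₀ p′ → p ≢ p′ →
        ¬ swapPos σ k₀ p ≈ swapPos σ k₀ p′
      separate-k₀-swaps {p} {p′} swaps swaps′ p≢p′ = p≢p′ ∘
        swapPos-injective {σ} {σ} {k₀} {p} {p′} closed closed (k₀-sides swaps) (k₀-sides swaps′)

    length-images : ∀ σ → m ∸ 1 ≤ length (images σ)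
    length-images σ = begin
      m ∸ 1
        ≤⟨ count-arithmetic 0<k k<n zero-swaps k₀-swaps ⟩
      length Q₁ + length Q₂
        ≡⟨ cong₂ _+_ (length-map (swapPos σ zero) Q₁) (length-map (swapPos σ k₀) Q₂) ⟨
      length (map (swapPos σ zero) Q₁) + length (map (swapPos σ k₀) Q₂)
        ≡⟨ length-++ (map (swapPos σ zero) Q₁) ⟨
      length (images σ)
        ∎
      where
      open ℕₚ.≤-Reasoning
      Q₁ = filter (swapsWithZero? σ) (allFin (suc m))
      Q₂ = filter (inRange? 1 (a + b)) (allFin (suc m))
      w = partnerᶠ (σ ⟨$⟩ʳ k₀)
      count-arithmetic : ∀ {N k X Y} → 0 < k → k < suc N → suc N ∸ k ≤ X + 1 → Y ≡ k ∸ 1 →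
        N ∸ 1 ≤ X + Y
      count-arithmetic {N} {suc k} {X} {Y} _ (s≤s k<N) N∸k≤X+1 refl = begin
        N ∸ 1                ≡⟨ cong (_∸ 1) (ℕₚ.m∸n+n≡m (ℕₚ.<⇒≤ k<N)) ⟨
        (N ∸ k + k) ∸ 1      ≤⟨ ℕₚ.∸-monoˡ-≤ 1 (ℕₚ.+-monoˡ-≤ k N∸k≤X+1) ⟩
        (X + 1 + k) ∸ 1      ≡⟨ cong (_∸ 1) (trans (ℕₚ.+-assoc X 1 k) (ℕₚ.+-suc X k)) ⟩
        X + k                ∎
      excluded : ∀ j → (if does (inRange? (a + b) (suc m) j) then 1 else 0) ≤
        (if does (swapsWithZero? σ j) then 1 else 0) + δ (partnerPos σ k₀) j
      excluded j = indicator-∧-not-≤ (does (inRange? (a + b) (suc m) j)) (does (σ ⟨$⟩ʳ j ≟ w)) hit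
        where
        hit : does (σ ⟨$⟩ʳ j ≟ w) ≡ true → δ (partnerPos σ k₀) j ≡ 1
        hit found with σ ⟨$⟩ʳ j ≟ w | found
        ... | yes σj≡w | _ rewrite dec-true (partnerPos σ k₀ ≟ j)
                                     (trans (cong (σ ⟨$⟩ˡ_) (sym σj≡w)) (inverseˡ σ)) = refl
      zero-swaps : suc m ∸ (a + b) ≤ length Q₁ + 1
      zero-swaps = begin
        suc m ∸ (a + b)
          ≡⟨ ∑-inRange (suc m) (a + b) (suc m) ℕₚ.≤-refl ⟨
        ∑[ j < suc m ] (if does (inRange? (a + b) (suc m) j) then 1 else 0)
          ≤⟨ ∑-mono-≤ excluded ⟩
        ∑[ j < suc m ] ((if does (swapsWithZero? σ j) then 1 else 0) + δ (partnerPos σ k₀) j)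
          ≡⟨ ∑-distrib-+ (λ j → if does (swapsWithZero? σ j) then 1 else 0) (δ (partnerPos σ k₀)) ⟩
        ∑[ j < suc m ] (if does (swapsWithZero? σ j) then 1 else 0) + ∑ (δ (partnerPos σ k₀))
          ≡⟨ cong₂ _+_ (sym (length-filter-allFin (swapsWithZero? σ))) (∑-δ (partnerPos σ k₀)) ⟩
        length Q₁ + 1
          ∎
      k₀-swaps : length Q₂ ≡ a + b ∸ 1
      k₀-swaps = trans (length-filter-allFin {suc m} (inRange? 1 (a + b)))
        (∑-inRange (suc m) 1 (a + b) (ℕₚ.<⇒≤ k<n))

    closed-bound : ∀ (C : List (Permutation′ (suc m))) → AllPairs Distinct C → All Closed C →
      length C * m ≤ (suc m) !
    closed-bound C distinct closed = begin
      length C * m                               ≡⟨ cong (length C *_) m≡ ⟨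
      length C * suc (m ∸ 1)                     ≡⟨ ℕₚ.*-suc (length C) (m ∸ 1) ⟩
      length C + length C * (m ∸ 1)              ≤⟨ ℕₚ.+-monoʳ-≤ (length C)
                                                      (length-concat-≥ images (λ {σ} _ → length-images σ) closed) ⟩
      length C + length (concat (map images C))  ≡⟨ length-++ C ⟨
      length (C ++ concat (map images C))        ≤⟨ length-≤-! (suc m) _
                                                      (AllPairsₚ.++⁺ distinct all-images-distinct cross) ⟩
      (suc m) !                                  ∎
      where
      open ℕₚ.≤-Reasoning
      m≡ : suc (m ∸ 1) ≡ m
      m≡ = trans (ℕₚ.+-comm 1 (m ∸ 1)) (ℕₚ.m∸n+n≡m (ℕₚ.≤-trans 0<k (ℕₚ.≤-pred k<n)))
      images-separated : ∀ {σ ρ} → Closed σ → Closed ρ → Distinct σ ρ →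
        All (λ τ → All (Distinct τ) (images ρ)) (images σ)
      images-separated {σ} {ρ} closedσ closedρ σ#ρ = All-All
        (λ {τ} {τ′} τ∈ τ′∈ → ≉⇒Distinct {σ = τ} {τ′}
          (Distinct⇒≉ {σ = σ} {ρ} σ#ρ ∘ images-disjoint {σ} {ρ} {τ} {τ′} closedσ closedρ τ∈ τ′∈))
        (images-IsImage σ) (images-IsImage ρ)
      all-images-distinct : AllPairs Distinct (concat (map images C))
      all-images-distinct = AllPairsₚ.concat⁺ (Allₚ.map⁺ (All.map (λ {σ} → images-distinct {σ}) closed))
        (AllPairsₚ.map⁺ (allPairs-restrict {R = Distinct} (λ {σ} {ρ} → images-separated {σ} {ρ}) closed distinct))
      not-closed : All (λ τ → ¬ Closed τ) (concat (map images C))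
      not-closed = Allₚ.concat⁺ (Allₚ.map⁺ (All.map (λ {σ} closedσ →
        All.map (λ {τ} → images-¬closed {σ} {τ} closedσ) (images-IsImage σ)) closed))
      cross : All (λ σ → All (Distinct σ) (concat (map images C))) C
      cross = All.map (λ {σ} closedσ → All.map (λ {τ} ¬closedτ →
        ≉⇒Distinct {σ = σ} {τ} (λ σ≈τ → ¬closedτ (Closed-cong {σ} {τ} σ≈τ closedσ))) not-closed) closed

    parity-bound : ∀ t (B : List (Permutation′ (suc m))) → AllPairs Distinct B →
      All (λ σ → D a b σ ≡ t mod 2) B → 2 * length B * m ≤ suc m * (suc m) !
    parity-bound t B distinct same-parity = begin
      2 * length B * m                                    ≡⟨ cong (λ x → 2 * x * m) (length-partition closed? B) ⟨
      2 * (length closedB + length openB) * m             ≡⟨ regroup (length closedB) (length openB) m ⟩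
      (length closedB + length openB + length openB) * m + length closedB * m
                                                          ≡⟨ cong (λ x → (x + length openB) * m + length closedB * m)
                                                                  (length-partition closed? B) ⟩
      (length B + length openB) * m + length closedB * m  ≤⟨ ℕₚ.+-mono-≤ (ℕₚ.*-monoˡ-≤ m flip-bound)
                                                               (closed-bound closedB closed-distinct closed-closed) ⟩
      (suc m) ! * m + (suc m) !                           ≡⟨ collect ((suc m) !) m ⟩
      suc m * (suc m) !                                   ∎
      where
      open ℕₚ.≤-Reasoning
      closedB = filter closed? B
      openB   = filter (¬? ∘ closed?) B
      closed-distinct : AllPairs Distinct closedB
      closed-distinct = AllPairsₚ.filter⁺ closed? distinct
      closed-closed : All Closed closedB
      closed-closed = Allₚ.all-filter closed? B
      regroup : ∀ c o m → 2 * (c + o) * m ≡ (c + o + o) * m + c * m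
      regroup = ℕSolver.solve-∀
      collect : ∀ N m → N * m + N ≡ suc m * N
      collect = ℕSolver.solve-∀
      open-parity : All (λ σ → ¬ Closed σ × D a b σ ≡ t mod 2) openB
      open-parity = All.zip (Allₚ.all-filter (¬? ∘ closed?) B , Allₚ.filter⁺ (¬? ∘ closed?) same-parity)
      flip-leaves-B : ∀ {σ ρ} → D a b σ ≡ t mod 2 → ¬ Closed ρ × D a b ρ ≡ t mod 2 → ¬ σ ≈ flip ρ
      flip-leaves-B {σ} {ρ} Dσ≡t (¬closedρ , Dρ≡t) σ≈flipρ = mod-2-odd Dσ≡t
        (mod-cong (sym (D-cong a b {σ} {flip ρ} σ≈flipρ)) refl
          (mod-trans (flip-parity ¬closedρ) (mod-+ Dρ≡t (mod-reflexive refl))))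
      flip-bound : length B + length openB ≤ (suc m) !
      flip-bound = begin
        length B + length openB             ≡⟨ cong (λ l → length B + l) (length-map flip openB) ⟨
        length B + length (map flip openB)  ≡⟨ length-++ B ⟨
        length (B ++ map flip openB)        ≤⟨ length-≤-! (suc m) _ (AllPairsₚ.++⁺ distinct flipped-distinct cross) ⟩
        (suc m) !                           ∎
        where
        flipped-distinct : AllPairs Distinct (map flip openB)
        flipped-distinct = map-Distinct flip (λ {σ} {ρ} → flip-injective {σ} {ρ})
          (AllPairsₚ.filter⁺ (¬? ∘ closed?) distinct)
        cross : All (λ σ → All (Distinct σ) (map flip openB)) B
        cross = All.map (λ {σ} Dσ≡t → Allₚ.map⁺ (All.map (λ {ρ} ρ-open →
          ≉⇒Distinct {σ = σ} {flip ρ} (flip-leaves-B {σ} {ρ} Dσ≡t ρ-open)) open-parity)) same-parity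

class-bound-odd : ∀ {m h} a → 2 ≤ a → a + (a ∸ 2) ≤ suc m → suc m ≡ suc (2 * h) → ∀ t {L} →
  AllPairs Distinct L → All (λ σ → D a (a ∸ 2) σ ≡ t mod suc m) L → length L * m ≤ (suc m) !
class-bound-odd {m} {h} a 2≤a window n≡2h+1 t {L} distinct L≡t = begin
  length L * m                 ≤⟨ ℕₚ.*-monoʳ-≤ (length L) (ℕₚ.n≤1+n m) ⟩
  length L * suc m             ≡⟨ ℕₚ.*-comm (length L) (suc m) ⟩
  suc m * length L             ≡⟨ length-rotations (suc m) L ⟨
  length (rotations (suc m) L) ≤⟨ length-≤-! (suc m) _
                                    (rotations-distinct a 2≤a window t no-wrap distinct L≡t (suc m) ℕₚ.≤-refl) ⟩
  (suc m) !                    ∎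
  where
  open ℕₚ.≤-Reasoning
  no-wrap : ∀ d → 0 < d → d < suc m → ¬ suc m ∣ℕ 2 * d
  no-wrap d 0<d d<n n∣2d = ℕₚ.even≢odd d h (trans (∣2d⇒2d≡n 0<d d<n n∣2d) n≡2h+1)

class-bound-even : ∀ {m h} a → 2 ≤ a → a + (a ∸ 2) < suc m → suc m ≡ 2 * h → ∀ t {L} →
  AllPairs Distinct L → All (λ σ → D a (a ∸ 2) σ ≡ t mod suc m) L → length L * m ≤ (suc m) !
class-bound-even {m} {h} a 2≤a k<n n≡2h t {L} distinct L≡t = ℕₚ.*-cancelˡ-≤ (suc m) (begin
  suc m * (length L * m)          ≡⟨ cong (λ n → n * (length L * m)) n≡2h ⟩
  2 * h * (length L * m)          ≡⟨ regroup h (length L) m ⟩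
  2 * (h * length L) * m          ≡⟨ cong (λ l → 2 * l * m) (length-rotations h L) ⟨
  2 * length (rotations h L) * m  ≤⟨ Parity.parity-bound {m} {h} n≡h+h a (a ∸ 2) 0<k k<n t (rotations h L)
                                       rotations-distinct′ same-parity ⟩
  suc m * (suc m) !               ∎)
  where
  open ℕₚ.≤-Reasoning
  n≡h+h : suc m ≡ h + h
  n≡h+h = trans n≡2h (cong (λ x → h + x) (ℕₚ.+-identityʳ h))
  0<k : 0 < a + (a ∸ 2)
  0<k = ℕₚ.<-≤-trans (s≤s z≤n) (ℕₚ.≤-trans 2≤a (ℕₚ.m≤m+n a (a ∸ 2)))
  regroup : ∀ h l m → 2 * h * (l * m) ≡ 2 * (h * l) * m
  regroup = ℕSolver.solve-∀
  no-wrap : ∀ d → 0 < d → d < h → ¬ suc m ∣ℕ 2 * d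
  no-wrap d 0<d d<h n∣2d = ℕₚ.<-irrefl (trans (∣2d⇒2d≡n 0<d d<n n∣2d) n≡2h) (ℕₚ.*-monoʳ-< 2 d<h)
    where
    d<n : d < suc m
    d<n = ℕₚ.<-≤-trans d<h (subst (h ≤_) (sym n≡h+h) (ℕₚ.m≤m+n h h))
  rotations-distinct′ : AllPairs Distinct (rotations h L)
  rotations-distinct′ = rotations-distinct a 2≤a (ℕₚ.<⇒≤ k<n) t no-wrap distinct L≡t h ℕₚ.≤-refl
  2∣n : 2 ∣ℕ suc m
  2∣n = ℕdivides h (trans n≡2h (ℕₚ.*-comm 2 h))
  same-parity : All (λ σ → D a (a ∸ 2) σ ≡ t mod 2) (rotations h L)
  same-parity = All.map (λ (i , _ , σ∈i) → mod-trans (mod-∣ 2∣n σ∈i) (shift-by-even t i))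
    (rotations-Class a 2≤a (ℕₚ.<⇒≤ k<n) t L≡t h)

class-bound : ∀ {m} a → 2 ≤ a → a + (a ∸ 2) < suc m → ∀ t {L} →
  AllPairs Distinct L → All (λ σ → D a (a ∸ 2) σ ≡ t mod suc m) L → length L * m ≤ (suc m) !
class-bound {m} a 2≤a k<n t distinct L≡t with even-or-odd (suc m)
... | inj₁ (h , n≡2h)   = class-bound-even {m} {h} a 2≤a k<n n≡2h t distinct L≡t
... | inj₂ (h , n≡2h+1) = class-bound-odd {m} {h} a 2≤a (ℕₚ.<⇒≤ k<n) n≡2h+1 t distinct L≡t

lemma3 : (n a : ℕ) → 1 ≤ n → 3 ≤ a → (a + a) ∸ 2 < n → (t : ℤ) →
         (L : List (Permutation′ n)) → AllPairs Distinct L →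
         All (λ σ → (+ n) ∣ (D a (a ∸ 2) σ - t)) L →
         length L * (n ∸ 1) ≤ n !
lemma3 (suc m) a _ 3≤a 2a-2<n t L distinct divisible =
  class-bound a 2≤a k<n t distinct (All.map (mod-intro ∘ Signed.∣ᵤ⇒∣) divisible)
  where
  2≤a : 2 ≤ a
  2≤a = ℕₚ.≤-trans (ℕₚ.n≤1+n 2) 3≤a
  k<n : a + (a ∸ 2) < suc m
  k<n = subst (_< suc m) (ℕₚ.+-∸-assoc a 2≤a) 2a-2<n
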